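{- Let $x_1,\dots,x_n$ be distinct elements of a universe $U$, and let $h_1:U\to\{1,2,\dots,\frac{n}{\log^2 n}\}$ be drawn from a pairwise independent family of hash functions. Call a bucket $j$ bad if more than $2\log^4 n$ of the keys $x_1,\dots,x_n$ are mapped to $j$ by $h_1$. Then the probability that more than $\frac{n}{\log^2 n}$ of the keys are mapped to bad buckets is at most $\frac12$.
   Context: A family $\mathcal H$ of functions $U\to R$ is pairwise independent if for $h$ drawn uniformly from $\mathcal H$ and any distinct $x\ne y\in U$, the pair $(h(x),h(y))$ is uniformly distributed on $R\times R$. -}

module Defs where

open import Data.Nat using (ℕ; zero; suc; _+_; _*_; _^_; _<_; _<?_)
open import Data.Fin using (Fin; zero; suc)
open import Data.Fin.Properties using (_≟_)
open import Data.Bool using (Bool; true; false; _∧_)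
open import Relation.Nullary.Decidable using (⌊_⌋)
open import Relation.Binary.PropositionalEquality using (_≡_; _≢_)

count : ∀ {k} → (Fin k → Bool) → ℕ
count {zero}  P = 0
count {suc k} P = (if P zero then 1 else 0) + count (λ i → P (suc i))
  where
  open import Data.Bool using (if_then_else_)

-- A finite family of hash functions U → Fin m, given as an enumeration
-- H : Fin k → (U → Fin m); drawing h uniformly = drawing i uniformly from Fin k.
-- Pairwise independence: for distinct x ≢ y and every (a , b),
--   Pr[h x = a ∧ h y = b] = 1 / m², i.e. #{i | H i x = a ∧ H i y = b} * m² = k.
PairwiseIndependent : ∀ {U : Set} {m k : ℕ} → (Fin k → U → Fin m) → Set
PairwiseIndependent {U} {m} {k} H =
  (x y : U) → x ≢ y → (a b : Fin m) →
  count (λ i → ⌊ H i x ≟ a ⌋ ∧ ⌊ H i y ≟ b ⌋) * (m * m) ≡ k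

load : ∀ {U : Set} {n m : ℕ} → (Fin n → U) → (U → Fin m) → Fin m → ℕ
load xs h j = count (λ i → ⌊ h (xs i) ≟ j ⌋)

-- bucket j is bad if more than 2·L⁴ keys map to it (L plays log n)
isBad : ∀ {U : Set} {n m : ℕ} → ℕ → (Fin n → U) → (U → Fin m) → Fin m → Bool
isBad L xs h j = ⌊ 2 * L ^ 4 <? load xs h j ⌋

keysInBad : ∀ {U : Set} {n m : ℕ} → ℕ → (Fin n → U) → (U → Fin m) → ℕ
keysInBad L xs h = count (λ i → isBad L xs h (h (xs i)))

-- Count ordered pairs of distinct keys that share a bucket. By pairwise independence two
-- fixed distinct keys collide under exactly k/m of the k hash functions, so over the whole
-- family there are at most n²k/m = m L⁴ k collisions. A key in a bad bucket collides with
-- at least 2L⁴ other keys, so a hash function sending more than m keys to bad buckets has at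
-- least (m+1)·2L⁴ collisions, and Markov's inequality bounds the number of such functions
-- by m L⁴ k / ((m+1)·2L⁴) < k/2.
module Submission where

open import Defs
open import Data.Nat using (ℕ; _*_; _^_; _≤_; _<?_)
open import Data.Nat.Logarithm using (⌊log₂_⌋)
open import Data.Fin using (Fin)
open import Function.Definitions using (Injective)
open import Relation.Binary.PropositionalEquality using (_≡_)
open import Relation.Nullary.Decidable using (⌊_⌋)

open import Data.Nat using (zero; suc; _+_; z≤n; NonZero)
open import Data.Nat.Properties hiding (_≟_)
open import Data.Fin using (zero; suc)
open import Data.Fin.Properties using (_≟_)
open import Data.Bool using (Bool; true; false; T; _∧_; not; if_then_else_)
open import Data.Unit using (tt)
open import Data.Empty using (⊥-elim)
open import Function using (_∘_)
open import Relation.Nullary using (¬_; yes; no)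
open import Relation.Nullary.Decidable using (toWitness; ⌊⌋-map′)
open import Relation.Binary.PropositionalEquality using (refl; sym; trans; cong; cong₂; subst; _≢_; module ≡-Reasoning)
open import Algebra.Properties.Semiring.Sum +-*-semiring using (sum; sum-syntax; sum-cong-≗; sum-replicate-zero; ∑-comm; *-distribʳ-sum)
open import Data.Nat.Solver using (module +-*-Solver)
open +-*-Solver using (solve; _:+_; _:*_; _:^_; _:=_; con)

𝟙 : Bool → ℕ
𝟙 b = if b then 1 else 0

𝟙≤1 : ∀ b → 𝟙 b ≤ 1
𝟙≤1 true  = ≤-refl
𝟙≤1 false = z≤n

∑-mono-≤ : ∀ {k} {f g : Fin k → ℕ} → (∀ i → f i ≤ g i) → sum f ≤ sum g
∑-mono-≤ {zero}  f≤g = z≤n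
∑-mono-≤ {suc k} f≤g = +-mono-≤ (f≤g zero) (∑-mono-≤ (λ i → f≤g (suc i)))

∑-const : ∀ k c → ∑[ i < k ] c ≡ k * c
∑-const zero    c = refl
∑-const (suc k) c = cong (c +_) (∑-const k c)

∑-bound : ∀ {k} {f : Fin k → ℕ} {c} → (∀ i → f i ≤ c) → sum f ≤ k * c
∑-bound {k} {c = c} f≤c = ≤-trans (∑-mono-≤ f≤c) (≤-reflexive (∑-const k c))

∑-pick : ∀ {m} (c : Fin m) (Q : Fin m → Bool) → ∑[ a < m ] 𝟙 (⌊ c ≟ a ⌋ ∧ Q a) ≡ 𝟙 (Q c)
∑-pick {suc m} zero    Q = trans (cong (𝟙 (Q zero) +_) (sum-replicate-zero m)) (+-identityʳ _)
∑-pick {suc m} (suc c) Q = begin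
  ∑[ a < m ] 𝟙 (⌊ suc c ≟ suc a ⌋ ∧ Q (suc a)) ≡⟨ sum-cong-≗ (λ a → cong (λ b → 𝟙 (b ∧ Q (suc a))) (⌊⌋-map′ _ _ (c ≟ a))) ⟩
  ∑[ a < m ] 𝟙 (⌊ c ≟ a ⌋ ∧ Q (suc a))         ≡⟨ ∑-pick c (λ a → Q (suc a)) ⟩
  𝟙 (Q (suc c))                                ∎
  where open ≡-Reasoning

count-cong : ∀ {k} {P Q : Fin k → Bool} → (∀ i → P i ≡ Q i) → count P ≡ count Q
count-cong {zero}  P≡Q = refl
count-cong {suc k} P≡Q = cong₂ (λ b c → 𝟙 b + c) (P≡Q zero) (count-cong (P≡Q ∘ suc))

count≡∑𝟙 : ∀ {k} (P : Fin k → Bool) → count P ≡ ∑[ i < k ] 𝟙 (P i)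
count≡∑𝟙 {zero}  P = refl
count≡∑𝟙 {suc k} P = cong (𝟙 (P zero) +_) (count≡∑𝟙 (P ∘ suc))

count-none : ∀ {k} (P : Fin k → Bool) → (∀ i → ¬ T (P i)) → count P ≡ 0
count-none {zero}  P none = refl
count-none {suc k} P none with P zero | none zero
... | true  | ¬T = ⊥-elim (¬T tt)
... | false | _  = count-none (P ∘ suc) (none ∘ suc)

count≤suc-count-except : ∀ {k} (p : Fin k) (P : Fin k → Bool) →
  count P ≤ suc (count (λ q → not ⌊ q ≟ p ⌋ ∧ P q))
count≤suc-count-except {suc k} zero P = +-monoˡ-≤ (count (P ∘ suc)) (𝟙≤1 (P zero))
count≤suc-count-except {suc k} (suc p) P = begin
  𝟙 (P zero) + count (P ∘ suc)                                      ≤⟨ +-monoʳ-≤ _ (count≤suc-count-except p (P ∘ suc)) ⟩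
  𝟙 (P zero) + suc (count (λ q → not ⌊ q ≟ p ⌋ ∧ P (suc q)))          ≡⟨ +-suc _ _ ⟩
  suc (𝟙 (P zero) + count (λ q → not ⌊ q ≟ p ⌋ ∧ P (suc q)))          ≡⟨ cong (λ c → suc (𝟙 (P zero) + c)) (count-cong same) ⟩
  suc (𝟙 (P zero) + count (λ q → not ⌊ suc q ≟ suc p ⌋ ∧ P (suc q))) ∎
  where
  open ≤-Reasoning
  same : ∀ q → not ⌊ q ≟ p ⌋ ∧ P (suc q) ≡ not ⌊ suc q ≟ suc p ⌋ ∧ P (suc q)
  same q = cong (λ b → not b ∧ P (suc q)) (sym (⌊⌋-map′ _ _ (q ≟ p)))

count-markov : ∀ {k} (P : Fin k → Bool) (f : Fin k → ℕ) c →
  (∀ i → T (P i) → c ≤ f i) → count P * c ≤ ∑[ i < k ] f i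
count-markov {k} P f c bound = begin
  count P * c                 ≡⟨ cong (_* c) (count≡∑𝟙 P) ⟩
  (∑[ i < k ] 𝟙 (P i)) * c    ≡⟨ *-distribʳ-sum c (𝟙 ∘ P) ⟩
  ∑[ i < k ] (𝟙 (P i) * c)    ≤⟨ ∑-mono-≤ (λ i → 𝟙-bound (P i) (bound i)) ⟩
  ∑[ i < k ] f i              ∎
  where
  open ≤-Reasoning
  𝟙-bound : ∀ b {x} → (T b → c ≤ x) → 𝟙 b * c ≤ x
  𝟙-bound true  c≤x = ≤-trans (≤-reflexive (*-identityˡ c)) (c≤x tt)
  𝟙-bound false _   = z≤n

count-by-value : ∀ {k m} (g : Fin k → Fin m) (Q : Fin k → Fin m → Bool) →
  count (λ i → Q i (g i)) ≡ ∑[ a < m ] count (λ i → ⌊ g i ≟ a ⌋ ∧ Q i a)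
count-by-value {k} {m} g Q = begin
  count (λ i → Q i (g i))                              ≡⟨ count≡∑𝟙 (λ i → Q i (g i)) ⟩
  ∑[ i < k ] 𝟙 (Q i (g i))                             ≡⟨ sum-cong-≗ (λ i → sym (∑-pick (g i) (Q i))) ⟩
  ∑[ i < k ] ∑[ a < m ] 𝟙 (⌊ g i ≟ a ⌋ ∧ Q i a)        ≡⟨ ∑-comm (λ i a → 𝟙 (⌊ g i ≟ a ⌋ ∧ Q i a)) ⟩
  ∑[ a < m ] ∑[ i < k ] 𝟙 (⌊ g i ≟ a ⌋ ∧ Q i a)        ≡⟨ sum-cong-≗ (λ a → sym (count≡∑𝟙 (λ i → ⌊ g i ≟ a ⌋ ∧ Q i a))) ⟩
  ∑[ a < m ] count (λ i → ⌊ g i ≟ a ⌋ ∧ Q i a)         ∎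
  where open ≡-Reasoning

∑∑count-comm : ∀ {k n l} (f : Fin k → Fin n → Fin l → Bool) →
  ∑[ i < k ] ∑[ p < n ] count (f i p) ≡ ∑[ p < n ] ∑[ q < l ] count (λ i → f i p q)
∑∑count-comm {k} {n} {l} f = begin
  ∑[ i < k ] ∑[ p < n ] count (f i p)                ≡⟨ sum-cong-≗ (λ i → sum-cong-≗ (λ p → count≡∑𝟙 (f i p))) ⟩
  ∑[ i < k ] ∑[ p < n ] ∑[ q < l ] 𝟙 (f i p q)       ≡⟨ ∑-comm (λ i p → ∑[ q < l ] 𝟙 (f i p q)) ⟩
  ∑[ p < n ] ∑[ i < k ] ∑[ q < l ] 𝟙 (f i p q)       ≡⟨ sum-cong-≗ (λ p → ∑-comm (λ i q → 𝟙 (f i p q))) ⟩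
  ∑[ p < n ] ∑[ q < l ] ∑[ i < k ] 𝟙 (f i p q)       ≡⟨ sum-cong-≗ (λ p → sum-cong-≗ (λ q → sym (count≡∑𝟙 (λ i → f i p q)))) ⟩
  ∑[ p < n ] ∑[ q < l ] count (λ i → f i p q)        ∎
  where open ≡-Reasoning

collision-count : ∀ {U : Set} {m k} (H : Fin k → U → Fin m) → PairwiseIndependent H → .{{_ : NonZero m}} →
  ∀ {x y} → x ≢ y → count (λ i → ⌊ H i y ≟ H i x ⌋) * m ≡ k
collision-count {m = m} {k} H indep {x} {y} x≢y = *-cancelʳ-≡ _ _ m (begin
  count (λ i → ⌊ H i y ≟ H i x ⌋) * m * m      ≡⟨ *-assoc (count (λ i → ⌊ H i y ≟ H i x ⌋)) m m ⟩
  count (λ i → ⌊ H i y ≟ H i x ⌋) * (m * m)    ≡⟨ cong (_* (m * m)) (count-by-value (λ i → H i x) (λ i a → ⌊ H i y ≟ a ⌋)) ⟩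
  (∑[ a < m ] both a) * (m * m)                ≡⟨ *-distribʳ-sum (m * m) both ⟩
  ∑[ a < m ] (both a * (m * m))                ≡⟨ sum-cong-≗ (λ a → indep x y x≢y a a) ⟩
  ∑[ a < m ] k                                 ≡⟨ ∑-const m k ⟩
  m * k                                        ≡⟨ *-comm m k ⟩
  k * m                                        ∎)
  where
  open ≡-Reasoning
  both : Fin m → ℕ
  both a = count (λ i → ⌊ H i x ≟ a ⌋ ∧ ⌊ H i y ≟ a ⌋)

module _ {U : Set} {n m : ℕ} (xs : Fin n → U) where

  -- Pairs are ordered: every unordered collision is counted twice.
  collides : (U → Fin m) → Fin n → Fin n → Bool
  collides h p q = not ⌊ q ≟ p ⌋ ∧ ⌊ h (xs q) ≟ h (xs p) ⌋

  collisions : (U → Fin m) → ℕ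
  collisions h = ∑[ p < n ] count (collides h p)

  ∑-collisions≤ : ∀ {k} (H : Fin k → U → Fin m) → Injective _≡_ _≡_ xs → PairwiseIndependent H →
    .{{_ : NonZero m}} → (∑[ i < k ] collisions (H i)) * m ≤ n * (n * k)
  ∑-collisions≤ {k} H inj indep = begin
    (∑[ i < k ] ∑[ p < n ] count (collides (H i) p)) * m  ≡⟨ cong (_* m) (∑∑count-comm (λ i → collides (H i))) ⟩
    (∑[ p < n ] ∑[ q < n ] hashes p q) * m                ≡⟨ *-distribʳ-sum m (λ p → ∑[ q < n ] hashes p q) ⟩
    ∑[ p < n ] ((∑[ q < n ] hashes p q) * m)              ≡⟨ sum-cong-≗ (λ p → *-distribʳ-sum m (hashes p)) ⟩
    ∑[ p < n ] ∑[ q < n ] (hashes p q * m)                ≤⟨ ∑-bound (λ p → ∑-bound (λ q → pair-bound p q)) ⟩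
    n * (n * k)                                           ∎
    where
    open ≤-Reasoning
    hashes : Fin n → Fin n → ℕ
    hashes p q = count (λ i → collides (H i) p q)
    pair-bound : ∀ p q → hashes p q * m ≤ k
    pair-bound p q with q ≟ p
    ... | yes _   = ≤-trans (≤-reflexive (cong (_* m) (count-none {k} _ (λ _ ())))) z≤n
    ... | no  q≢p = ≤-reflexive (collision-count H indep (λ xp≡xq → q≢p (inj (sym xp≡xq))))

  keysInBad*≤collisions : ∀ L (h : U → Fin m) → keysInBad L xs h * (2 * L ^ 4) ≤ collisions h
  keysInBad*≤collisions L h = count-markov _ _ (2 * L ^ 4) λ p bad →
    m<1+n⇒m≤n (<-≤-trans (toWitness bad) (count≤suc-count-except p (λ q → ⌊ h (xs q) ≟ h (xs p) ⌋)))

  overloaded : ℕ → (U → Fin m) → Bool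
  overloaded L h = ⌊ m <? keysInBad L xs h ⌋

  overloaded*≤∑-collisions : ∀ L {k} (H : Fin k → U → Fin m) →
    count (λ i → overloaded L (H i)) * ((1 + m) * (2 * L ^ 4)) ≤ ∑[ i < k ] collisions (H i)
  overloaded*≤∑-collisions L H = count-markov _ _ _ λ i over →
    ≤-trans (*-monoˡ-≤ (2 * L ^ 4) (toWitness over)) (keysInBad*≤collisions L (H i))

2*≤-from-collision-bound : ∀ B m L {k n} .{{_ : NonZero n}} → n ≡ m * L ^ 2 →
  B * ((1 + m) * (2 * L ^ 4)) * m ≤ n * (n * k) → 2 * B ≤ k
2*≤-from-collision-bound B m L {k} {n} n≡mL² bound =
  *-cancelʳ-≤ (2 * B) k (1 + m)
    (≤-trans (*-cancelʳ-≤ (2 * B * (1 + m)) (k * m) (n * n) {{m*n≢0 n n}} scaled) (*-monoʳ-≤ k (n≤1+n m)))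
  where
  open ≤-Reasoning
  scaled : 2 * B * (1 + m) * (n * n) ≤ k * m * (n * n)
  scaled = begin
    2 * B * (1 + m) * (n * n)                   ≡⟨ cong (λ n → 2 * B * (1 + m) * (n * n)) n≡mL² ⟩
    2 * B * (1 + m) * (m * L ^ 2 * (m * L ^ 2)) ≡⟨ solve 3 (λ B m L → con 2 :* B :* (con 1 :+ m) :* (m :* L :^ 2 :* (m :* L :^ 2))
                                                           := B :* ((con 1 :+ m) :* (con 2 :* L :^ 4)) :* m :* m) refl B m L ⟩
    B * ((1 + m) * (2 * L ^ 4)) * m * m         ≤⟨ *-monoˡ-≤ m bound ⟩
    n * (n * k) * m                             ≡⟨ solve 3 (λ n m k → n :* (n :* k) :* m := k :* m :* (n :* n)) refl n m k ⟩
    k * m * (n * n)                             ∎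

mainTheorem5 : {U : Set} (n m L k : ℕ) → L ≡ ⌊log₂ n ⌋ → n ≡ m * L ^ 2 →
    (xs : Fin n → U) → Injective _≡_ _≡_ xs →
    (H : Fin k → U → Fin m) → PairwiseIndependent H →
    2 * count (λ i → ⌊ m <? keysInBad L xs (H i) ⌋) ≤ k
mainTheorem5 zero m L k _ _ xs _ H _ =
  ≤-trans (≤-reflexive (cong (2 *_) (count-none (overloaded xs L ∘ H) (λ i over → n≮0 (toWitness {a? = m <? 0} over))))) z≤n
mainTheorem5 (suc _) m L k _ n≡mL² xs inj H indep =
  2*≤-from-collision-bound (count (overloaded xs L ∘ H)) m L n≡mL²
    (≤-trans (*-monoˡ-≤ m (overloaded*≤∑-collisions xs L H)) (∑-collisions≤ xs H inj indep))
  where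
  instance
    nonZero-m : NonZero m
    nonZero-m = m*n≢0⇒m≢0 m {{subst NonZero n≡mL² _}}
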